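{- For all $n\ge 1$, $$\overline{q}_n(123,132,213)=\frac{(1+\sqrt{2})^{n+1}}{4}+\frac{(1-\sqrt{2})^{n+1}}{4}-\frac{(-1)^{n+1}}{2}.$$
   Context: For a positive integer $n$, let $\mathcal{S}_{n,n}$ denote the set of all permutations (words) $\pi=\pi_1\cdots\pi_{2n}$ of the multiset $\{1,1,2,2,\ldots,n,n\}$. A word $\pi$ contains a pattern $\sigma=\sigma_1\cdots\sigma_k$ if there are indices $i_1<\cdots<i_k$ such that $\pi_{i_a}=\pi_{i_b}$ iff $\sigma_a=\sigma_b$ and $\pi_{i_a}<\pi_{i_b}$ iff $\sigma_a<\sigma_b$ for all $a,b$; otherwise $\pi$ avoids $\sigma$. The quasi-Stirling permutations $\overline{\mathcal{Q}}_n$ are the $\pi\in\mathcal{S}_{n,n}$ avoiding both $1212$ and $2121$. For a set $\Lambda$ of patterns, $\overline{\mathcal{Q}}_n(\Lambda)$ is the set of $\pi\in\overline{\mathcal{Q}}_n$ avoiding every pattern in $\Lambda$, and $\overline{q}_n(\Lambda)=|\overline{\mathcal{Q}}_n(\Lambda)|$. -}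

module Defs where

open import Data.Nat using (ℕ; zero; suc; _+_; _*_; _<ᵇ_; _≡ᵇ_)
open import Data.Bool using (Bool; true; false; _∧_; not; _xor_)
open import Data.Bool.ListAction using (all; any)
open import Data.List using (List; []; _∷_; map; length; filterᵇ; concatMap; upTo; zip; _++_; sum)
open import Data.Product using (_×_; _,_)
open import Data.Integer as ℤ using (ℤ)

wordsOver : ℕ → ℕ → List (List ℕ)
wordsOver zero    n = [] ∷ []
wordsOver (suc k) n = concatMap (λ w → map (λ a → suc a ∷ w) (upTo n)) (wordsOver k n)

occ : ℕ → List ℕ → ℕ
occ a []       = 0
occ a (x ∷ xs) = (if' (a ≡ᵇ x)) + occ a xs
  where
  if' : Bool → ℕ
  if' true  = 1
  if' false = 0

isMultisetPerm : ℕ → List ℕ → Bool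
isMultisetPerm n π = all (λ a → occ (suc a) π ≡ᵇ 2) (upTo n)

S : ℕ → List (List ℕ)
S n = filterᵇ (isMultisetPerm n) (wordsOver (2 * n) n)

subseqs : List ℕ → List (List ℕ)
subseqs []       = [] ∷ []
subseqs (x ∷ xs) = map (x ∷_) (subseqs xs) ++ subseqs xs

_⇔ᵇ_ : Bool → Bool → Bool
a ⇔ᵇ b = not (a xor b)

sameCmp : ℕ → ℕ → ℕ → ℕ → Bool
sameCmp x x' y y' = ((x ≡ᵇ x') ⇔ᵇ (y ≡ᵇ y')) ∧ ((x <ᵇ x') ⇔ᵇ (y <ᵇ y'))

-- order-isomorphism of two words: same length and for all positions a<b,
-- s_a = s_b iff t_a = t_b and s_a < s_b iff t_a < t_b
-- (positions a = b are trivial, a > b follows by symmetry)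
orderIso : List ℕ → List ℕ → Bool
orderIso []       []       = true
orderIso []       (_ ∷ _)  = false
orderIso (_ ∷ _)  []       = false
orderIso (s ∷ ss) (t ∷ ts) =
  all (λ { (s' , t') → sameCmp s s' t t' }) (zip ss ts) ∧ orderIso ss ts

contains : List ℕ → List ℕ → Bool
contains π σ = any (orderIso σ) (subseqs π)

avoids : List ℕ → List ℕ → Bool
avoids π σ = not (contains π σ)

avoidsAll : List (List ℕ) → List ℕ → Bool
avoidsAll Λ π = all (avoids π) Λ

isQuasiStirling : List ℕ → Bool
isQuasiStirling π = avoidsAll ((1 ∷ 2 ∷ 1 ∷ 2 ∷ []) ∷ (2 ∷ 1 ∷ 2 ∷ 1 ∷ []) ∷ []) π

Qbar : ℕ → List (List ℕ) → List (List ℕ)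
Qbar n Λ = filterᵇ (λ π → isQuasiStirling π ∧ avoidsAll Λ π) (S n)

qbar : ℕ → List (List ℕ) → ℕ
qbar n Λ = length (Qbar n Λ)

record ℤ√2 : Set where
  constructor _+_√2
  field
    re : ℤ
    ir : ℤ

infixl 6 _⊕_ _⊖_
infixl 7 _⊗_

_⊕_ : ℤ√2 → ℤ√2 → ℤ√2
(a + b √2) ⊕ (c + d √2) = (a ℤ.+ c) + (b ℤ.+ d) √2

_⊖_ : ℤ√2 → ℤ√2 → ℤ√2
(a + b √2) ⊖ (c + d √2) = (a ℤ.- c) + (b ℤ.- d) √2

_⊗_ : ℤ√2 → ℤ√2 → ℤ√2
(a + b √2) ⊗ (c + d √2) = (a ℤ.* c ℤ.+ ℤ.+ 2 ℤ.* b ℤ.* d) + (a ℤ.* d ℤ.+ b ℤ.* c) √2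

ι : ℤ → ℤ√2
ι a = a + ℤ.0ℤ √2

_^√_ : ℤ√2 → ℕ → ℤ√2
x ^√ zero  = ι ℤ.1ℤ
x ^√ suc k = x ⊗ (x ^√ k)

onePlusSqrt2 : ℤ√2
onePlusSqrt2 = ℤ.1ℤ + ℤ.1ℤ √2

oneMinusSqrt2 : ℤ√2
oneMinusSqrt2 = ℤ.1ℤ + ℤ.-1ℤ √2

-- Every word of Q̄_n(123,132,213) is a block of its largest letters followed by a word of
-- Q̄_m(123,132,213) on the letters 1..m. The first letter is n or n-1, since anything smaller,
-- followed later by n-1 and n, is an occurrence of 123 or 132; avoiding 213, 1212 and 2121 then
-- forces the block to be one of  nn, n(n-1)(n-1)n, (n-1)(n-1)nn, (n-1)nn(n-1) and
-- (n-1)nn(n-2)(n-2)(n-1). Conversely, all five forbidden patterns are skew-indecomposable, so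
-- stacking a valid block on a valid word gives a valid word. Hence
-- q_n = q_{n-1} + 3 q_{n-2} + q_{n-3}, whose characteristic polynomial
-- x³ - x² - 3x - 1 = (x + 1)(x² - 2x - 1) has the roots -1 and 1 ± √2; the initial values
-- q_0 = q_1 = 1, q_2 = 4 fix the coefficients.

module Submission where

open import Defs
open import Data.Bool using (Bool; true; false; _∧_; T; T?)
open import Data.Bool.Properties using (T-≡; T-not-≡; T-∧)
open import Data.Bool.ListAction using (all; any)
open import Data.Empty using (⊥; ⊥-elim)
open import Data.Integer as ℤ using (ℤ)
open import Data.Integer.Properties using (pos-+; pos-*)
import Data.Integer.Tactic.RingSolver as ℤ-Solver
open import Data.List using (List; []; _∷_; map; length; filterᵇ; concat; upTo; applyUpTo; zip; _++_; take; drop)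
open import Data.List.Properties using (length-++; length-map; ++-identityʳ; ++-cancelˡ; ≡-dec)
open import Data.List.Membership.Propositional using (_∈_; find; lose)
open import Data.List.Membership.Propositional.Properties
open import Data.List.Membership.Propositional.Properties.WithK using (unique∧set⇒bag)
open import Data.List.Relation.Binary.BagAndSetEquality using (∼bag⇒↭)
open import Data.List.Relation.Binary.Disjoint.Propositional using (Disjoint)
open import Data.List.Relation.Binary.Permutation.Propositional.Properties using (↭-length)
open import Data.List.Relation.Binary.Sublist.Propositional
  using (_⊆_; []; _∷_; _∷ʳ_; from∈; ⊆-refl; ⊆-trans)
open import Data.List.Relation.Binary.Sublist.Propositional.Properties using (All-resp-⊆; ++⁺ˡ)
open import Data.List.Relation.Unary.All as All using (All; []; _∷_)
import Data.List.Relation.Unary.All.Properties as All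
open import Data.List.Relation.Unary.Any using (here; there)
import Data.List.Relation.Unary.Any.Properties as Any
import Data.List.Relation.Unary.AllPairs as AllPairs
import Data.List.Relation.Unary.AllPairs.Properties as AllPairs
open import Data.List.Relation.Unary.Unique.Propositional using (Unique)
import Data.List.Relation.Unary.Unique.Propositional.Properties as Unique
import Data.List.Relation.Unary.Unique.DecPropositional as UniqueDec
open import Data.Nat
  using (ℕ; zero; suc; pred; _+_; _*_; _∸_; _≤_; _<_; _≥_; z≤n; s≤s; z<s; _≡ᵇ_; _<ᵇ_; _≤?_; _<?_)
open import Data.Nat.Induction using (<-rec)
open import Data.Nat.ListAction using (sum)
open import Data.Nat.Properties
open import Data.Nat.Tactic.RingSolver using (solve-∀)
open import Data.Product using (∃; ∃₂; _×_; _,_; proj₁; proj₂)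
open import Data.Sum using (_⊎_; inj₁; inj₂)
open import Function using (_∘_; _⇔_; mk⇔; Equivalence)
open import Relation.Binary.Definitions using (tri<; tri≈; tri>)
open import Relation.Binary.PropositionalEquality
open import Relation.Nullary using (¬_; Dec; yes; no; ¬?)
open import Relation.Nullary.Decidable as Dec using (from-yes; _×-dec_)

unique-same-elements⇒length≡ : ∀ {A : Set} {xs ys : List A} → Unique xs → Unique ys →
                                (∀ {x} → x ∈ xs ⇔ x ∈ ys) → length xs ≡ length ys
unique-same-elements⇒length≡ ux uy xs⇔ys = ↭-length (∼bag⇒↭ (unique∧set⇒bag ux uy xs⇔ys))

∈-filterᵇ⁺ : ∀ {A : Set} (p : A → Bool) {x xs} → x ∈ xs → T (p x) → x ∈ filterᵇ p xs
∈-filterᵇ⁺ p = ∈-filter⁺ (T? ∘ p)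

∈-filterᵇ⁻ : ∀ {A : Set} (p : A → Bool) {x xs} → x ∈ filterᵇ p xs → x ∈ xs × T (p x)
∈-filterᵇ⁻ p = ∈-filter⁻ (T? ∘ p)

Letter : ℕ → ℕ → Set
Letter n a = 1 ≤ a × a ≤ n

prependEach : ℕ → List ℕ → List (List ℕ)
prependEach n w = map (λ a → suc a ∷ w) (upTo n)

∈-wordsOver⁻ : ∀ k n {w} → w ∈ wordsOver k n → length w ≡ k × All (Letter n) w
∈-wordsOver⁻ zero n (here refl) = refl , []
∈-wordsOver⁻ (suc k) n w∈
  with v , v∈ , w∈′ ← find (∈-concatMap⁻ (prependEach n) {xs = wordsOver k n} w∈)
  with a , a<n , refl ← ∈-map⁻ (λ a → suc a ∷ v) w∈′
  with |v|≡k , letters ← ∈-wordsOver⁻ k n v∈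
  = cong suc |v|≡k , (s≤s z≤n , ∈-upTo⁻ a<n) ∷ letters

∈-wordsOver⁺ : ∀ k n {w} → length w ≡ k → All (Letter n) w → w ∈ wordsOver k n
∈-wordsOver⁺ zero n {[]} refl [] = here refl
∈-wordsOver⁺ (suc k) n {suc a ∷ w} refl ((_ , a≤n) ∷ letters) =
  ∈-concatMap⁺ (prependEach n) {xs = wordsOver k n}
    (lose (∈-wordsOver⁺ k n refl letters) (∈-map⁺ (λ b → suc b ∷ w) (∈-upTo⁺ a≤n)))

wordsOver-unique : ∀ k n → Unique (wordsOver k n)
wordsOver-unique zero n = [] AllPairs.∷ AllPairs.[]
wordsOver-unique (suc k) n =
  Unique.concat⁺ {xss = map (prependEach n) (wordsOver k n)}
    (All.map⁺ (All.universal prependEach-unique (wordsOver k n)))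
    (AllPairs.map⁺ (AllPairs.map prependEach-disjoint (wordsOver-unique k n)))
  where
  prependEach-unique : ∀ w → Unique (prependEach n w)
  prependEach-unique w = Unique.map⁺ (λ { refl → refl }) (Unique.upTo⁺ n)
  prependEach-disjoint : ∀ {v w} → v ≢ w → Disjoint (prependEach n v) (prependEach n w)
  prependEach-disjoint v≢w (x∈v , x∈w) with ∈-map⁻ _ x∈v | ∈-map⁻ _ x∈w
  ... | _ , _ , refl | _ , _ , refl = v≢w refl

¬T⇒≡false : ∀ {b} → ¬ T b → b ≡ false
¬T⇒≡false {false} _  = refl
¬T⇒≡false {true}  ¬t = ⊥-elim (¬t _)

≡ᵇ-refl : ∀ n → (n ≡ᵇ n) ≡ true
≡ᵇ-refl n = Equivalence.to T-≡ (≡⇒≡ᵇ n n refl)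

≢⇒≡ᵇ≡false : ∀ {m n} → m ≢ n → (m ≡ᵇ n) ≡ false
≢⇒≡ᵇ≡false {m} {n} m≢n = ¬T⇒≡false (m≢n ∘ ≡ᵇ⇒≡ m n)

<⇒<ᵇ≡true : ∀ {m n} → m < n → (m <ᵇ n) ≡ true
<⇒<ᵇ≡true m<n = Equivalence.to T-≡ (<⇒<ᵇ m<n)

≥⇒<ᵇ≡false : ∀ {m n} → n ≤ m → (m <ᵇ n) ≡ false
≥⇒<ᵇ≡false {m} {n} n≤m = ¬T⇒≡false (≤⇒≯ n≤m ∘ <ᵇ⇒< m n)

≡ᵇ-+ʳ : ∀ k m n → (m + k ≡ᵇ n + k) ≡ (m ≡ᵇ n)
≡ᵇ-+ʳ k m n rewrite +-comm m k | +-comm n k = ≡ᵇ-+ˡ k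
  where
  ≡ᵇ-+ˡ : ∀ k → (k + m ≡ᵇ k + n) ≡ (m ≡ᵇ n)
  ≡ᵇ-+ˡ zero    = refl
  ≡ᵇ-+ˡ (suc k) = ≡ᵇ-+ˡ k

<ᵇ-+ʳ : ∀ k m n → (m + k <ᵇ n + k) ≡ (m <ᵇ n)
<ᵇ-+ʳ k m n rewrite +-comm m k | +-comm n k = <ᵇ-+ˡ k
  where
  <ᵇ-+ˡ : ∀ k → (k + m <ᵇ k + n) ≡ (m <ᵇ n)
  <ᵇ-+ˡ zero    = refl
  <ᵇ-+ˡ (suc k) = <ᵇ-+ˡ k

∈-subseqs⁺ : ∀ {u w} → u ⊆ w → u ∈ subseqs w
∈-subseqs⁺ []                    = here refl
∈-subseqs⁺ (_∷ʳ_ {ys = w} x u⊆w) = ∈-++⁺ʳ (map (x ∷_) (subseqs w)) (∈-subseqs⁺ u⊆w)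
∈-subseqs⁺ (refl ∷ u⊆w)          = ∈-++⁺ˡ (∈-map⁺ _ (∈-subseqs⁺ u⊆w))

∈-subseqs⁻ : ∀ w {u} → u ∈ subseqs w → u ⊆ w
∈-subseqs⁻ []      (here refl) = []
∈-subseqs⁻ (x ∷ w) u∈ with ∈-++⁻ (map (x ∷_) (subseqs w)) u∈
... | inj₁ u∈′ with _ , u′∈ , refl ← ∈-map⁻ (x ∷_) u∈′ = refl ∷ ∈-subseqs⁻ w u′∈
... | inj₂ u∈′ = x ∷ʳ ∈-subseqs⁻ w u∈′

⊆-++⁻ : ∀ {A : Set} (p : List A) {t u} → u ⊆ p ++ t → ∃₂ λ s r → s ⊆ p × r ⊆ t × u ≡ s ++ r
⊆-++⁻ []      u⊆t = [] , _ , [] , u⊆t , refl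
⊆-++⁻ (x ∷ p) (_ ∷ʳ u⊆)   with s , r , s⊆p , r⊆t , refl ← ⊆-++⁻ p u⊆ = s , r , x ∷ʳ s⊆p , r⊆t , refl
⊆-++⁻ (x ∷ p) (refl ∷ u⊆) with s , r , s⊆p , r⊆t , refl ← ⊆-++⁻ p u⊆ =
  x ∷ s , r , refl ∷ s⊆p , r⊆t , refl

⊆-map⁻ : ∀ {A B : Set} (f : A → B) c {u} → u ⊆ map f c → ∃ λ v → v ⊆ c × u ≡ map f v
⊆-map⁻ f []      [] = [] , [] , refl
⊆-map⁻ f (x ∷ c) (_ ∷ʳ u⊆) with v , v⊆c , refl ← ⊆-map⁻ f c u⊆ = v , x ∷ʳ v⊆c , refl
⊆-map⁻ f (x ∷ c) (refl ∷ u⊆) with v , v⊆c , refl ← ⊆-map⁻ f c u⊆ = x ∷ v , refl ∷ v⊆c , refl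

pair⊆⊎swapped⊆ : ∀ {A : Set} {a b : A} {w} → a ≢ b → a ∈ w → b ∈ w →
                 (a ∷ b ∷ []) ⊆ w ⊎ (b ∷ a ∷ []) ⊆ w
pair⊆⊎swapped⊆ a≢b (here refl) (here refl) = ⊥-elim (a≢b refl)
pair⊆⊎swapped⊆ a≢b (here refl) (there b∈) = inj₁ (refl ∷ from∈ b∈)
pair⊆⊎swapped⊆ a≢b (there a∈) (here refl) = inj₂ (refl ∷ from∈ a∈)
pair⊆⊎swapped⊆ a≢b (there a∈) (there b∈) with pair⊆⊎swapped⊆ a≢b a∈ b∈
... | inj₁ ab⊆ = inj₁ (_ ∷ʳ ab⊆)
... | inj₂ ba⊆ = inj₂ (_ ∷ʳ ba⊆)

-- Order isomorphism and pattern avoidance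

T-∧⁻ : ∀ {a b} → T (a ∧ b) → T a × T b
T-∧⁻ {a} = Equivalence.to (T-∧ {a})

orderIso-length : ∀ σ u → T (orderIso σ u) → length σ ≡ length u
orderIso-length []      []      _   = refl
orderIso-length (_ ∷ σ) (_ ∷ u) iso = cong suc (orderIso-length σ u (proj₂ (T-∧⁻ iso)))

all-zip-+ʳ : ∀ k (g h : ℕ × ℕ → Bool) → (∀ a b → g (a , b + k) ≡ h (a , b)) →
             ∀ σ v → all g (zip σ (map (_+ k) v)) ≡ all h (zip σ v)
all-zip-+ʳ k g h g≡h []      v       = refl
all-zip-+ʳ k g h g≡h (_ ∷ _) []      = refl
all-zip-+ʳ k g h g≡h (s ∷ σ) (t ∷ v) = cong₂ _∧_ (g≡h s t) (all-zip-+ʳ k g h g≡h σ v)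

orderIso-+ʳ : ∀ k σ v → orderIso σ (map (_+ k) v) ≡ orderIso σ v
orderIso-+ʳ k []      []      = refl
orderIso-+ʳ k []      (_ ∷ _) = refl
orderIso-+ʳ k (_ ∷ _) []      = refl
orderIso-+ʳ k (s ∷ σ) (t ∷ v) = cong₂ _∧_ (all-zip-+ʳ k _ _ sameCmp-+ʳ σ v) (orderIso-+ʳ k σ v)
  where
  sameCmp-+ʳ : ∀ a b → sameCmp s a (t + k) (b + k) ≡ sameCmp s a t b
  sameCmp-+ʳ a b = cong₂ (λ e l → ((s ≡ᵇ a) ⇔ᵇ e) ∧ ((s <ᵇ a) ⇔ᵇ l)) (≡ᵇ-+ʳ k t b) (<ᵇ-+ʳ k t b)

Above : List ℕ → List ℕ → Set
Above xs ys = All (λ x → All (_< x) ys) xs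

above? : ∀ xs ys → Dec (Above xs ys)
above? xs ys = All.all? (λ x → All.all? (_<? x) ys) xs

Above-resp-⊆ : ∀ {s p r t} → s ⊆ p → r ⊆ t → Above p t → Above s r
Above-resp-⊆ s⊆p r⊆t p>t = All.map (All-resp-⊆ r⊆t) (All-resp-⊆ s⊆p p>t)

sameCmp-< : ∀ {a b x y} → y < x → T (sameCmp a b x y) → b < a
sameCmp-< {a} {b} {x} {y} y<x same with <-cmp b a
... | tri< b<a _ _ = b<a
... | tri≈ _ refl _ rewrite ≡ᵇ-refl b | ≢⇒≡ᵇ≡false (>⇒≢ y<x) with () ← same
... | tri> _ b≢a a<b
  rewrite ≢⇒≡ᵇ≡false (≢-sym b≢a) | <⇒<ᵇ≡true a<b
        | ≢⇒≡ᵇ≡false (>⇒≢ y<x) | ≥⇒<ᵇ≡false (<⇒≤ y<x)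
  with () ← same

all-zip-++⁻ʳ : ∀ (g : ℕ × ℕ → Bool) σ₁ {σ₂} s {r} → length σ₁ ≡ length s →
               T (all g (zip (σ₁ ++ σ₂) (s ++ r))) → T (all g (zip σ₂ r))
all-zip-++⁻ʳ g []       []      _      t = t
all-zip-++⁻ʳ g (_ ∷ σ₁) (_ ∷ s) |σ₁|≡ t =
  all-zip-++⁻ʳ g σ₁ s (suc-injective |σ₁|≡) (proj₂ (T-∧⁻ t))

all-zip-below : ∀ (g : ℕ × ℕ → Bool) {a x} → (∀ {b y} → y < x → T (g (b , y)) → b < a) →
                ∀ σ r → All (_< x) r → length σ ≡ length r → T (all g (zip σ r)) → All (_< a) σ
all-zip-below g below []      []      _           _      _ = []
all-zip-below g below (b ∷ σ) (y ∷ r) (y<x ∷ r<x) |σ|≡|r| t =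
  below y<x (proj₁ (T-∧⁻ t)) ∷ all-zip-below g below σ r r<x (suc-injective |σ|≡|r|) (proj₂ (T-∧⁻ t))

orderIso-split : ∀ σ s r → T (orderIso σ (s ++ r)) → Above s r →
  ∃₂ λ σ₁ σ₂ → σ ≡ σ₁ ++ σ₂ × length σ₁ ≡ length s × length σ₂ ≡ length r × Above σ₁ σ₂
orderIso-split σ [] r iso _ = [] , σ , refl , refl , orderIso-length σ r iso , []
orderIso-split (a ∷ σ) (x ∷ s) r iso (r<x ∷ s>r)
  with σ₁ , σ₂ , refl , |σ₁|≡ , |σ₂|≡ , σ₁>σ₂ ← orderIso-split σ s r (proj₂ (T-∧⁻ iso)) s>r
  = a ∷ σ₁ , σ₂ , refl , cong suc |σ₁|≡ , |σ₂|≡ , σ₂<a ∷ σ₁>σ₂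
  where
  σ₂<a : All (_< a) σ₂
  σ₂<a = all-zip-below _ sameCmp-< σ₂ r r<x |σ₂|≡ (all-zip-++⁻ʳ _ σ₁ s |σ₁|≡ (proj₁ (T-∧⁻ iso)))

Avoids : List ℕ → List ℕ → Set
Avoids w σ = ∀ {u} → u ⊆ w → ¬ T (orderIso σ u)

T-avoids : ∀ w σ → T (avoids w σ) ⇔ Avoids w σ
T-avoids w σ = mk⇔ to from
  where
  to : T (avoids w σ) → Avoids w σ
  to t u⊆w iso = subst T (Equivalence.to T-not-≡ t) (Any.any⁺ (orderIso σ) (lose (∈-subseqs⁺ u⊆w) iso))
  from : Avoids w σ → T (avoids w σ)
  from av with any (orderIso σ) (subseqs w) in found
  ... | false = _
  ... | true with u , u∈ , iso ← find (Any.any⁻ (orderIso σ) (subseqs w) (Equivalence.from T-≡ found))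
    = av (∈-subseqs⁻ w u∈) iso

T-avoidsAll : ∀ Λ w → T (avoidsAll Λ w) ⇔ All (Avoids w) Λ
T-avoidsAll Λ w = mk⇔
  (All.map (λ {σ} → Equivalence.to (T-avoids w σ)) ∘ All.all⁺ (avoids w) Λ)
  (All.all⁻ (avoids w) ∘ All.map (λ {σ} → Equivalence.from (T-avoids w σ)))

avoids-++⁻ʳ : ∀ p {t σ} → Avoids (p ++ t) σ → Avoids t σ
avoids-++⁻ʳ p av u⊆t = av (++⁺ˡ p u⊆t)

avoids-+ʳ : ∀ k {c σ} → Avoids c σ → Avoids (map (_+ k) c) σ
avoids-+ʳ k {c} {σ} av u⊆ with v , v⊆c , refl ← ⊆-map⁻ (_+ k) c u⊆ =
  subst (λ b → ¬ T b) (sym (orderIso-+ʳ k σ v)) (av v⊆c)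

SkewIndecomposable : List ℕ → Set
SkewIndecomposable σ =
  ∀ σ₁ σ₂ → σ ≡ σ₁ ++ σ₂ → 0 < length σ₁ → 0 < length σ₂ → ¬ Above σ₁ σ₂

avoids-++ : ∀ {σ p t} → SkewIndecomposable σ → Avoids p σ → Avoids t σ → Above p t →
            Avoids (p ++ t) σ
avoids-++ {σ} {p} indec av-p av-t p>t u⊆ iso
  with ⊆-++⁻ p u⊆
... | s , [] , s⊆p , _ , refl rewrite ++-identityʳ s = av-p s⊆p iso
... | [] , r , _ , r⊆t , refl = av-t r⊆t iso
... | x ∷ s , y ∷ r , s⊆p , r⊆t , refl
  with σ₁ , σ₂ , σ≡ , |σ₁|≡ , |σ₂|≡ , σ₁>σ₂
       ← orderIso-split σ (x ∷ s) (y ∷ r) iso (Above-resp-⊆ s⊆p r⊆t p>t)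
  = indec σ₁ σ₂ σ≡ (subst (0 <_) (sym |σ₁|≡) z<s) (subst (0 <_) (sym |σ₂|≡) z<s) σ₁>σ₂

take-length-++ : ∀ {A : Set} (xs ys : List A) → take (length xs) (xs ++ ys) ≡ xs
take-length-++ []       ys = refl
take-length-++ (x ∷ xs) ys = cong (x ∷_) (take-length-++ xs ys)

drop-length-++ : ∀ {A : Set} (xs ys : List A) → drop (length xs) (xs ++ ys) ≡ ys
drop-length-++ []       ys = refl
drop-length-++ (x ∷ xs) ys = drop-length-++ xs ys

NoAboveCut : List ℕ → Set
NoAboveCut σ = All (λ k → ¬ Above (take k σ) (drop k σ)) (applyUpTo suc (pred (length σ)))

noAboveCut? : ∀ σ → Dec (NoAboveCut σ)
noAboveCut? σ = All.all? (λ k → ¬? (above? (take k σ) (drop k σ))) _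

noAboveCut⇒skewIndecomposable : ∀ σ → NoAboveCut σ → SkewIndecomposable σ
noAboveCut⇒skewIndecomposable _ noCut σ₁@(_ ∷ σ₁′) σ₂ refl _ 0<|σ₂| σ₁>σ₂ =
  All.lookup noCut (∈-applyUpTo⁺ suc |σ₁′|<)
    (subst₂ Above (sym (take-length-++ σ₁ σ₂)) (sym (drop-length-++ σ₁ σ₂)) σ₁>σ₂)
  where
  |σ₁′|< : length σ₁′ < length (σ₁′ ++ σ₂)
  |σ₁′|< = subst (length σ₁′ <_) (sym (length-++ σ₁′)) (m<m+n (length σ₁′) 0<|σ₂|)

σ123 σ132 σ213 σ1212 σ2121 : List ℕ
σ123  = 1 ∷ 2 ∷ 3 ∷ []
σ132  = 1 ∷ 3 ∷ 2 ∷ []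
σ213  = 2 ∷ 1 ∷ 3 ∷ []
σ1212 = 1 ∷ 2 ∷ 1 ∷ 2 ∷ []
σ2121 = 2 ∷ 1 ∷ 2 ∷ 1 ∷ []

quasiStirlingPatterns Λ₃ forbidden : List (List ℕ)
quasiStirlingPatterns = σ1212 ∷ σ2121 ∷ []
Λ₃ = σ123 ∷ σ132 ∷ σ213 ∷ []
forbidden = quasiStirlingPatterns ++ Λ₃

forbidden-skewIndecomposable : All SkewIndecomposable forbidden
forbidden-skewIndecomposable =
  All.map (λ {σ} → noAboveCut⇒skewIndecomposable σ) (from-yes (All.all? noAboveCut? forbidden))

orderIso-123 : ∀ {x y z} → x < y → y < z → T (orderIso σ123 (x ∷ y ∷ z ∷ []))
orderIso-123 x<y y<z
  rewrite ≢⇒≡ᵇ≡false (<⇒≢ x<y) | <⇒<ᵇ≡true x<y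
        | ≢⇒≡ᵇ≡false (<⇒≢ y<z) | <⇒<ᵇ≡true y<z
        | ≢⇒≡ᵇ≡false (<⇒≢ (<-trans x<y y<z)) | <⇒<ᵇ≡true (<-trans x<y y<z) = _

orderIso-132 : ∀ {x y z} → x < z → z < y → T (orderIso σ132 (x ∷ y ∷ z ∷ []))
orderIso-132 x<z z<y
  rewrite ≢⇒≡ᵇ≡false (<⇒≢ x<z) | <⇒<ᵇ≡true x<z
        | ≢⇒≡ᵇ≡false (>⇒≢ z<y) | ≥⇒<ᵇ≡false (<⇒≤ z<y)
        | ≢⇒≡ᵇ≡false (<⇒≢ (<-trans x<z z<y)) | <⇒<ᵇ≡true (<-trans x<z z<y) = _

orderIso-213 : ∀ {x y z} → y < x → x < z → T (orderIso σ213 (x ∷ y ∷ z ∷ []))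
orderIso-213 y<x x<z
  rewrite ≢⇒≡ᵇ≡false (>⇒≢ y<x) | ≥⇒<ᵇ≡false (<⇒≤ y<x)
        | ≢⇒≡ᵇ≡false (<⇒≢ x<z) | <⇒<ᵇ≡true x<z
        | ≢⇒≡ᵇ≡false (<⇒≢ (<-trans y<x x<z)) | <⇒<ᵇ≡true (<-trans y<x x<z) = _

orderIso-1212 : ∀ {a b} → a < b → T (orderIso σ1212 (a ∷ b ∷ a ∷ b ∷ []))
orderIso-1212 {a} {b} a<b
  rewrite ≢⇒≡ᵇ≡false (<⇒≢ a<b) | <⇒<ᵇ≡true a<b
        | ≢⇒≡ᵇ≡false (>⇒≢ a<b) | ≥⇒<ᵇ≡false (<⇒≤ a<b)
        | ≡ᵇ-refl a | ≡ᵇ-refl b | ≥⇒<ᵇ≡false (≤-refl {a}) | ≥⇒<ᵇ≡false (≤-refl {b}) = _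

orderIso-2121 : ∀ {a b} → a < b → T (orderIso σ2121 (b ∷ a ∷ b ∷ a ∷ []))
orderIso-2121 {a} {b} a<b
  rewrite ≢⇒≡ᵇ≡false (<⇒≢ a<b) | <⇒<ᵇ≡true a<b
        | ≢⇒≡ᵇ≡false (>⇒≢ a<b) | ≥⇒<ᵇ≡false (<⇒≤ a<b)
        | ≡ᵇ-refl a | ≡ᵇ-refl b | ≥⇒<ᵇ≡false (≤-refl {a}) | ≥⇒<ᵇ≡false (≤-refl {b}) = _

record InQbar (n : ℕ) (w : List ℕ) : Set where
  field
    length≡          : length w ≡ 2 * n
    letters          : All (Letter n) w
    twice            : ∀ a → a < n → occ (suc a) w ≡ 2
    avoidsForbidden  : All (Avoids w) forbidden

T-isMultisetPerm : ∀ n w → T (isMultisetPerm n w) ⇔ (∀ a → a < n → occ (suc a) w ≡ 2)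
T-isMultisetPerm n w = mk⇔
  (λ t a a<n → ≡ᵇ⇒≡ _ 2 (All.lookup (All.all⁺ twiceᵇ (upTo n) t) (∈-upTo⁺ a<n)))
  (λ twice → All.all⁻ twiceᵇ (All.tabulate λ a∈ → ≡⇒≡ᵇ _ 2 (twice _ (∈-upTo⁻ a∈))))
  where
  twiceᵇ : ℕ → Bool
  twiceᵇ a = occ (suc a) w ≡ᵇ 2

T-avoidsForbidden : ∀ w → T (isQuasiStirling w ∧ avoidsAll Λ₃ w) ⇔ All (Avoids w) forbidden
T-avoidsForbidden w = mk⇔
  (λ t → let qs , av = T-∧⁻ t in
    All.++⁺ (Equivalence.to (T-avoidsAll quasiStirlingPatterns w) qs) (Equivalence.to (T-avoidsAll Λ₃ w) av))
  (λ av → let qs , av₃ = All.++⁻ quasiStirlingPatterns av in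
    Equivalence.from T-∧ ( Equivalence.from (T-avoidsAll quasiStirlingPatterns w) qs
                         , Equivalence.from (T-avoidsAll Λ₃ w) av₃))

InQbar⇔ : ∀ n w → InQbar n w ⇔ ( length w ≡ 2 * n × All (Letter n) w
                                × T (isMultisetPerm n w) × T (isQuasiStirling w ∧ avoidsAll Λ₃ w))
InQbar⇔ n w = mk⇔
  (λ W → InQbar.length≡ W , InQbar.letters W ,
         Equivalence.from (T-isMultisetPerm n w) (InQbar.twice W) ,
         Equivalence.from (T-avoidsForbidden w) (InQbar.avoidsForbidden W))
  (λ (length≡ , letters , perm , avoiding) → record
    { length≡ = length≡ ; letters = letters
    ; twice = Equivalence.to (T-isMultisetPerm n w) perm
    ; avoidsForbidden = Equivalence.to (T-avoidsForbidden w) avoiding })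

inQbar? : ∀ n w → Dec (InQbar n w)
inQbar? n w = Dec.map′ (Equivalence.from (InQbar⇔ n w)) (Equivalence.to (InQbar⇔ n w))
  ((length w ≟ 2 * n) ×-dec All.all? (λ a → (1 ≤? a) ×-dec (a ≤? n)) w ×-dec T? _ ×-dec T? _)

∈-Qbar⇔ : ∀ n w → w ∈ Qbar n Λ₃ ⇔ InQbar n w
∈-Qbar⇔ n w = mk⇔
  (λ w∈ → let w∈S , avoiding = ∈-filterᵇ⁻ _ w∈
              w∈words , perm = ∈-filterᵇ⁻ (isMultisetPerm n) w∈S
              length≡ , letters = ∈-wordsOver⁻ (2 * n) n w∈words
          in Equivalence.from (InQbar⇔ n w) (length≡ , letters , perm , avoiding))
  (λ W → let length≡ , letters , perm , avoiding = Equivalence.to (InQbar⇔ n w) W in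
    ∈-filterᵇ⁺ _ (∈-filterᵇ⁺ (isMultisetPerm n) (∈-wordsOver⁺ (2 * n) n length≡ letters) perm) avoiding)

Qbar-unique : ∀ n → Unique (Qbar n Λ₃)
Qbar-unique n =
  Unique.filter⁺ (T? ∘ _) (Unique.filter⁺ (T? ∘ isMultisetPerm n) (wordsOver-unique (2 * n) n))

-- Stacking a block on a word

occ-here : ∀ a w → occ a (a ∷ w) ≡ suc (occ a w)
occ-here a w rewrite ≡ᵇ-refl a = refl

occ-there : ∀ {a x} w → a ≢ x → occ a (x ∷ w) ≡ occ a w
occ-there w a≢x rewrite ≢⇒≡ᵇ≡false a≢x = refl

occ-++ : ∀ a xs ys → occ a (xs ++ ys) ≡ occ a xs + occ a ys
occ-++ a []       ys = refl
occ-++ a (x ∷ xs) ys rewrite occ-++ a xs ys = sym (+-assoc _ (occ a xs) (occ a ys))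

occ-+ʳ : ∀ k a w → occ (a + k) (map (_+ k) w) ≡ occ a w
occ-+ʳ k a []      = refl
occ-+ʳ k a (x ∷ w) rewrite ≡ᵇ-+ʳ k a x | occ-+ʳ k a w = refl

occ-∉ : ∀ {a} w → All (a ≢_) w → occ a w ≡ 0
occ-∉ []      []            = refl
occ-∉ (_ ∷ w) (a≢x ∷ a∉w) = trans (occ-there w a≢x) (occ-∉ w a∉w)

occ≡suc⇒∈ : ∀ {a c} w → occ a w ≡ suc c → a ∈ w
occ≡suc⇒∈ {a} (x ∷ w) occ≡ with a ≟ x
... | yes refl = here refl
... | no a≢x   = there (occ≡suc⇒∈ w (trans (sym (occ-there w a≢x)) occ≡))

∈⇒occ≢0 : ∀ {a w} → a ∈ w → occ a w ≢ 0
∈⇒occ≢0 {a} {_ ∷ w} (here refl) occ≡0 with () ← trans (sym (occ-here a w)) occ≡0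
∈⇒occ≢0 {a} {x ∷ w} (there a∈w) occ≡0 with a ≟ x
... | yes refl with () ← trans (sym (occ-here a w)) occ≡0
... | no a≢x = ∈⇒occ≢0 a∈w (trans (sym (occ-there w a≢x)) occ≡0)

onTop : List ℕ → ℕ → List ℕ → List ℕ
onTop c m t = map (_+ m) c ++ t

letters-+ʳ : ∀ {k m c} → All (Letter k) c → All (Letter (k + m)) (map (_+ m) c)
letters-+ʳ {m = m} = All.map⁺ ∘ All.map λ (1≤a , a≤k) → ≤-trans 1≤a (m≤m+n _ m) , +-monoˡ-≤ m a≤k

letters-+ʳ-above : ∀ {k m c} → All (Letter k) c → All (m <_) (map (_+ m) c)
letters-+ʳ-above {m = m} = All.map⁺ ∘ All.map λ (1≤a , _) → +-monoˡ-≤ m 1≤a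

letter-cases : ∀ m a → a < m ⊎ ∃ λ e → a ≡ e + m
letter-cases m a with a <? m
... | yes a<m = inj₁ a<m
... | no a≮m  = inj₂ (a ∸ m , sym (m∸n+n≡m (≮⇒≥ a≮m)))

occ-above : ∀ {m a} t → All (_≤ m) t → m < a → occ a t ≡ 0
occ-above t t≤m m<a = occ-∉ t (All.map (λ y≤m → ≢-sym (<⇒≢ (≤-<-trans y≤m m<a))) t≤m)

occ-onTop-shifted : ∀ a c m t → occ (a + m) (onTop c m t) ≡ occ a c + occ (a + m) t
occ-onTop-shifted a c m t =
  trans (occ-++ (a + m) (map (_+ m) c) t) (cong (_+ occ (a + m) t) (occ-+ʳ m a c))

occ-onTop-low : ∀ {k a} c m t → All (Letter k) c → a ≤ m → occ a (onTop c m t) ≡ occ a t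
occ-onTop-low {a = a} c m t c-letters a≤m = trans (occ-++ a (map (_+ m) c) t)
  (cong (_+ occ a t) (occ-∉ _ (All.map (λ m<x → <⇒≢ (≤-<-trans a≤m m<x)) (letters-+ʳ-above c-letters))))

length-onTop : ∀ {k c} m t → InQbar k c → length (onTop c m t) ≡ 2 * k + length t
length-onTop {c = c} m t C =
  trans (length-++ (map (_+ m) c)) (cong (_+ length t) (trans (length-map (_+ m) c) (InQbar.length≡ C)))

onTop-InQbar : ∀ {k m c t} → InQbar k c → InQbar m t → InQbar (k + m) (onTop c m t)
onTop-InQbar {k} {m} {c} {t} C T′ = record
  { length≡ = begin
      length (onTop c m t)  ≡⟨ length-onTop m t C ⟩
      2 * k + length t      ≡⟨ cong (2 * k +_) (InQbar.length≡ T′) ⟩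
      2 * k + 2 * m         ≡⟨ *-distribˡ-+ 2 k m ⟨
      2 * (k + m)           ∎
  ; letters = All.++⁺ (letters-+ʳ (InQbar.letters C))
                      (All.map (λ (1≤a , a≤m) → 1≤a , ≤-trans a≤m (m≤n+m m k)) (InQbar.letters T′))
  ; twice = twice-onTop
  ; avoidsForbidden = All.zipWith
      (λ {σ} (indec , av-c , av-t) {u} → avoids-++ indec (avoids-+ʳ m {σ = σ} av-c) av-t c>t {u})
      (forbidden-skewIndecomposable , All.zip (InQbar.avoidsForbidden C , InQbar.avoidsForbidden T′))
  }
  where
  open ≡-Reasoning
  t≤m : All (_≤ m) t
  t≤m = All.map proj₂ (InQbar.letters T′)
  c>t : Above (map (_+ m) c) t
  c>t = All.map (λ m<x → All.map (λ y≤m → ≤-<-trans y≤m m<x) t≤m) (letters-+ʳ-above (InQbar.letters C))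
  twice-onTop : ∀ a → a < k + m → occ (suc a) (onTop c m t) ≡ 2
  twice-onTop a a<k+m with letter-cases m a
  ... | inj₁ a<m = trans (occ-onTop-low c m t (InQbar.letters C) a<m) (InQbar.twice T′ a a<m)
  ... | inj₂ (e , refl) = begin
      occ (suc e + m) (onTop c m t)      ≡⟨ occ-onTop-shifted (suc e) c m t ⟩
      occ (suc e) c + occ (suc e + m) t  ≡⟨ cong₂ _+_ (InQbar.twice C e (+-cancelʳ-< m e k a<k+m))
                                                     (occ-above t t≤m (m<n+m m z<s)) ⟩
      2 + 0                              ∎

onTop-InQbar⁻ʳ : ∀ {k m c t} → InQbar k c → InQbar (k + m) (onTop c m t) → InQbar m t
onTop-InQbar⁻ʳ {k} {m} {c} {t} C W = record
  { length≡ = +-cancelˡ-≡ (2 * k) _ _ (begin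
      2 * k + length t      ≡⟨ length-onTop m t C ⟨
      length (onTop c m t)  ≡⟨ InQbar.length≡ W ⟩
      2 * (k + m)           ≡⟨ *-distribˡ-+ 2 k m ⟩
      2 * k + 2 * m         ∎)
  ; letters = All.tabulate λ x∈t → letter x∈t (All.lookup (All.++⁻ʳ (map (_+ m) c) (InQbar.letters W)) x∈t)
  ; twice = λ a a<m →
      trans (sym (occ-onTop-low c m t (InQbar.letters C) a<m)) (InQbar.twice W a (≤-trans a<m (m≤n+m m k)))
  ; avoidsForbidden = All.map (λ {σ} → avoids-++⁻ʳ (map (_+ m) c) {σ = σ}) (InQbar.avoidsForbidden W)
  }
  where
  open ≡-Reasoning
  -- a letter of t above m would occur twice in the shifted c already
  letter : ∀ {x} → x ∈ t → Letter (k + m) x → Letter m x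
  letter {x} x∈t (1≤x , x≤k+m) with letter-cases m x
  ... | inj₁ x<m = 1≤x , <⇒≤ x<m
  ... | inj₂ (zero , refl) = 1≤x , ≤-refl
  ... | inj₂ (suc e , refl) = ⊥-elim (∈⇒occ≢0 x∈t (+-cancelˡ-≡ 2 _ _ (begin
      2 + occ (suc e + m) t              ≡⟨ cong (_+ occ (suc e + m) t) (InQbar.twice C e (+-cancelʳ-< m e k x≤k+m)) ⟨
      occ (suc e) c + occ (suc e + m) t  ≡⟨ occ-onTop-shifted (suc e) c m t ⟨
      occ (suc e + m) (onTop c m t)      ≡⟨ InQbar.twice W (e + m) x≤k+m ⟩
      2                                  ∎)))

-- Enumeration by leading block

blk11 blk2112 blk1122 blk1221 blk233112 : List ℕ
blk11     = 1 ∷ 1 ∷ []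
blk2112   = 2 ∷ 1 ∷ 1 ∷ 2 ∷ []
blk1122   = 1 ∷ 1 ∷ 2 ∷ 2 ∷ []
blk1221   = 1 ∷ 2 ∷ 2 ∷ 1 ∷ []
blk233112 = 2 ∷ 3 ∷ 3 ∷ 1 ∷ 1 ∷ 2 ∷ []

blocks₂ : List (List ℕ)
blocks₂ = blk2112 ∷ blk1122 ∷ blk1221 ∷ []

blk11-InQbar : InQbar 1 blk11
blk11-InQbar = from-yes (inQbar? 1 blk11)

blocks₂-InQbar : All (InQbar 2) blocks₂
blocks₂-InQbar = from-yes (All.all? (inQbar? 2) blocks₂)

blk233112-InQbar : InQbar 3 blk233112
blk233112-InQbar = from-yes (inQbar? 3 blk233112)

withBlocks₂ : ℕ → List (List ℕ) → List (List (List ℕ))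
withBlocks₂ m ts = map (λ c → map (onTop c m) ts) blocks₂

blockFamilies : ℕ → (q₂ q₁ q₀ : List (List ℕ)) → List (List (List ℕ))
blockFamilies j q₂ q₁ q₀ =
  map (onTop blk11 (suc (suc j))) q₂ ∷ withBlocks₂ (suc j) q₁ ++ map (onTop blk233112 j) q₀ ∷ []

qWords : ℕ → List (List ℕ)
qWords 0 = [] ∷ []
qWords 1 = map (onTop blk11 0) (qWords 0)
qWords 2 = concat (map (onTop blk11 1) (qWords 1) ∷ withBlocks₂ 0 (qWords 0))
qWords (suc (suc (suc j))) = concat (blockFamilies j (qWords (suc (suc j))) (qWords (suc j)) (qWords j))

qFamilies : ℕ → List (List (List ℕ))
qFamilies j = blockFamilies j (qWords (2 + j)) (qWords (1 + j)) (qWords j)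

length-concat : ∀ (xss : List (List (List ℕ))) → length (concat xss) ≡ sum (map length xss)
length-concat []         = refl
length-concat (xs ∷ xss) = trans (length-++ xs) (cong (length xs +_) (length-concat xss))

length-qWords : ∀ j →
  length (qWords (3 + j)) ≡ length (qWords (2 + j)) + 3 * length (qWords (1 + j)) + length (qWords j)
length-qWords j = trans (length-concat (qFamilies j)) (trans family-lengths (regroup ℓ₂ ℓ₁ ℓ₀))
  where
  ℓ₂ ℓ₁ ℓ₀ : ℕ
  ℓ₂ = length (qWords (2 + j))
  ℓ₁ = length (qWords (1 + j))
  ℓ₀ = length (qWords j)
  family-lengths : sum (map length (qFamilies j)) ≡ ℓ₂ + (ℓ₁ + (ℓ₁ + (ℓ₁ + (ℓ₀ + 0))))
  family-lengths =
    cong₂ _+_ (length-map (onTop blk11 (2 + j)) (qWords (2 + j)))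
    (cong₂ _+_ (length-map (onTop blk2112 (1 + j)) (qWords (1 + j)))
    (cong₂ _+_ (length-map (onTop blk1122 (1 + j)) (qWords (1 + j)))
    (cong₂ _+_ (length-map (onTop blk1221 (1 + j)) (qWords (1 + j)))
    (cong (_+ 0) (length-map (onTop blk233112 j) (qWords j))))))
  regroup : ∀ a b c → a + (b + (b + (b + (c + 0)))) ≡ a + 3 * b + c
  regroup = solve-∀

∈-onTop-InQbar : ∀ {k m c ts w} → InQbar k c → (∀ {t} → t ∈ ts → InQbar m t) →
                 w ∈ map (onTop c m) ts → InQbar (k + m) w
∈-onTop-InQbar {m = m} {c = c} C ts-valid w∈ with _ , t∈ , refl ← ∈-map⁻ (onTop c m) w∈ = onTop-InQbar C (ts-valid t∈)

∈-withBlocks₂-InQbar : ∀ {m ts xs w} → (∀ {t} → t ∈ ts → InQbar m t) → xs ∈ withBlocks₂ m ts → w ∈ xs →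
                       InQbar (2 + m) w
∈-withBlocks₂-InQbar {m} {ts} ts-valid xs∈ w∈ with c , c∈ , refl ← ∈-map⁻ (λ c → map (onTop c m) ts) xs∈ =
  ∈-onTop-InQbar (All.lookup blocks₂-InQbar c∈) ts-valid w∈

qWords-sound-step : ∀ j →
  (∀ {t} → t ∈ qWords (2 + j) → InQbar (2 + j) t) → (∀ {t} → t ∈ qWords (1 + j) → InQbar (1 + j) t) →
  (∀ {t} → t ∈ qWords j → InQbar j t) → ∀ {w} → w ∈ qWords (3 + j) → InQbar (3 + j) w
qWords-sound-step j sound₂ sound₁ sound₀ w∈ =
  let _ , w∈xs , xs∈ = ∈-concat⁻′ (qFamilies j) w∈ in family-sound xs∈ w∈xs
  where
  family-sound : ∀ {xs w} → xs ∈ qFamilies j → w ∈ xs → InQbar (3 + j) w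
  family-sound (here refl) = ∈-onTop-InQbar blk11-InQbar sound₂
  family-sound (there xs∈) with ∈-++⁻ (withBlocks₂ (suc j) (qWords (suc j))) xs∈
  ... | inj₁ xs∈₂        = ∈-withBlocks₂-InQbar sound₁ xs∈₂
  ... | inj₂ (here refl) = ∈-onTop-InQbar blk233112-InQbar sound₀

qWords-sound : ∀ n {w} → w ∈ qWords n → InQbar n w
qWords-sound 0 = All.lookup (from-yes (All.all? (inQbar? 0) (qWords 0)))
qWords-sound 1 = All.lookup (from-yes (All.all? (inQbar? 1) (qWords 1)))
qWords-sound 2 = All.lookup (from-yes (All.all? (inQbar? 2) (qWords 2)))
qWords-sound (suc (suc (suc j))) =
  qWords-sound-step j (qWords-sound (suc (suc j))) (qWords-sound (suc j)) (qWords-sound j)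

onTop-unique : ∀ c m {ts} → Unique ts → Unique (map (onTop c m) ts)
onTop-unique c m = Unique.map⁺ (++-cancelˡ (map (_+ m) c) _ _)

onTop-disjoint : ∀ c m c′ m′ {ts ts′} → (∀ {t t′} → onTop c m t ≢ onTop c′ m′ t′) →
                 Disjoint (map (onTop c m) ts) (map (onTop c′ m′) ts′)
onTop-disjoint c m c′ m′ different (w∈ , w∈′)
  with _ , _ , refl ← ∈-map⁻ (onTop c m) w∈ | _ , _ , same ← ∈-map⁻ (onTop c′ m′) w∈′ = different same

qWords-unique : ∀ n → Unique (qWords n)
qWords-unique 0 = from-yes (UniqueDec.unique? (≡-dec _≟_) (qWords 0))
qWords-unique 1 = from-yes (UniqueDec.unique? (≡-dec _≟_) (qWords 1))
qWords-unique 2 = from-yes (UniqueDec.unique? (≡-dec _≟_) (qWords 2))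
qWords-unique (suc (suc (suc j))) = Unique.concat⁺
  (  onTop-unique blk11     (2 + j) (qWords-unique (suc (suc j)))
   ∷ onTop-unique blk2112   (1 + j) (qWords-unique (suc j))
   ∷ onTop-unique blk1122   (1 + j) (qWords-unique (suc j))
   ∷ onTop-unique blk1221   (1 + j) (qWords-unique (suc j))
   ∷ onTop-unique blk233112 j       (qWords-unique j)
   ∷ [])
  -- two words with different leading blocks already differ in their first four letters
  (  (  onTop-disjoint blk11 (2 + j) blk2112 (1 + j) (λ ())   ∷ onTop-disjoint blk11 (2 + j) blk1122 (1 + j) (λ ())
      ∷ onTop-disjoint blk11 (2 + j) blk1221 (1 + j) (λ ())   ∷ onTop-disjoint blk11 (2 + j) blk233112 j (λ ()) ∷ [])
  AllPairs.∷
     (  onTop-disjoint blk2112 (1 + j) blk1122 (1 + j) (λ ()) ∷ onTop-disjoint blk2112 (1 + j) blk1221 (1 + j) (λ ())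
      ∷ onTop-disjoint blk2112 (1 + j) blk233112 j (λ ()) ∷ [])
  AllPairs.∷
     (onTop-disjoint blk1122 (1 + j) blk1221 (1 + j) (λ ()) ∷ onTop-disjoint blk1122 (1 + j) blk233112 j (λ ()) ∷ [])
  AllPairs.∷ (onTop-disjoint blk1221 (1 + j) blk233112 j (λ ()) ∷ [])
  AllPairs.∷ [] AllPairs.∷ AllPairs.[])

∈-qWords-11 : ∀ m {t} → t ∈ qWords m → onTop blk11 m t ∈ qWords (suc m)
∈-qWords-11 0             t∈ = ∈-map⁺ (onTop blk11 0) t∈
∈-qWords-11 1             t∈ =
  ∈-concat⁺′ {xss = map (onTop blk11 1) (qWords 1) ∷ withBlocks₂ 0 (qWords 0)} (∈-map⁺ (onTop blk11 1) t∈) (here refl)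
∈-qWords-11 (suc (suc j)) t∈ = ∈-concat⁺′ {xss = qFamilies j} (∈-map⁺ (onTop blk11 (2 + j)) t∈) (here refl)

∈-qWords-2 : ∀ m {c t} → c ∈ blocks₂ → t ∈ qWords m → onTop c m t ∈ qWords (2 + m)
∈-qWords-2 zero    {c} c∈ t∈ = ∈-concat⁺′ {xss = map (onTop blk11 1) (qWords 1) ∷ withBlocks₂ 0 (qWords 0)}
  (∈-map⁺ (onTop c 0) t∈) (there (∈-map⁺ (λ c → map (onTop c 0) (qWords 0)) c∈))
∈-qWords-2 (suc j) {c} c∈ t∈ = ∈-concat⁺′ {xss = qFamilies j}
  (∈-map⁺ (onTop c (suc j)) t∈) (there (∈-++⁺ˡ (∈-map⁺ (λ c → map (onTop c (suc j)) (qWords (suc j))) c∈)))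

∈-qWords-233112 : ∀ j {t} → t ∈ qWords j → onTop blk233112 j t ∈ qWords (3 + j)
∈-qWords-233112 j t∈ = ∈-concat⁺′ {xss = qFamilies j}
  (∈-map⁺ (onTop blk233112 j) t∈) (there (∈-++⁺ʳ (withBlocks₂ (suc j) (qWords (suc j))) (here refl)))

-- Completeness of the enumeration

-- A record rather than occ a w ≡ c, so that a and w remain inferable.
record Occurs (a : ℕ) (w : List ℕ) (c : ℕ) : Set where
  constructor occurs
  field occ≡ : occ a w ≡ c

occurs-here : ∀ {a w c} → Occurs a (a ∷ w) (suc c) → Occurs a w c
occurs-here {a} {w} (occurs occ≡) = occurs (suc-injective (trans (sym (occ-here a w)) occ≡))

occurs-here-0 : ∀ {a w} → ¬ Occurs a (a ∷ w) 0
occurs-here-0 {a} {w} (occurs occ≡) with () ← trans (sym (occ-here a w)) occ≡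

occurs-there : ∀ {a x w c} → a ≢ x → Occurs a (x ∷ w) c → Occurs a w c
occurs-there {w = w} a≢x (occurs occ≡) = occurs (trans (sym (occ-there w a≢x)) occ≡)

occurs-[] : ∀ {a c} → ¬ Occurs a [] (suc c)
occurs-[] (occurs ())

occurs⇒⊆ : ∀ {a w c} → Occurs a w (suc c) → (a ∷ []) ⊆ w
occurs⇒⊆ {w = w} (occurs occ≡) = from∈ (occ≡suc⇒∈ w occ≡)

occurs-later : ∀ {a x w c} → a ≢ x → Occurs a (x ∷ w) (suc c) → (a ∷ []) ⊆ w
occurs-later a≢x = occurs⇒⊆ ∘ occurs-there a≢x

occurs-twice : ∀ {n w} → InQbar n w → ∀ a → a < n → Occurs (suc a) w 2
occurs-twice W a a<n = occurs (InQbar.twice W a a<n)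

largest-twice : ∀ {m w} → InQbar (suc m) w → Occurs (suc m) w 2
largest-twice W = occurs-twice W _ (n<1+n _)

second-twice : ∀ {k w} → InQbar (2 + k) w → Occurs (suc k) w 2
second-twice W = occurs-twice W _ (m<n+m _ z<s)

1≤letter : ∀ {n w a} → InQbar n w → a ∈ w → 1 ≤ a
1≤letter W a∈w = proj₁ (All.lookup (InQbar.letters W) a∈w)

letter≤ : ∀ {n w a} → InQbar n w → a ∈ w → a ≤ n
letter≤ W a∈w = proj₂ (All.lookup (InQbar.letters W) a∈w)

data Rank (a M : ℕ) : Set where
  lower   : a < M → Rank a M
  second  : a ≡ M → Rank a M
  largest : a ≡ suc M → Rank a M

rank : ∀ {a M} → a ≤ suc M → Rank a M
rank {a} {M} a≤1+M with <-cmp a M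
... | tri< a<M _ _ = lower a<M
... | tri≈ _ a≡M _ = second a≡M
... | tri> _ _ M<a = largest (≤-antisym a≤1+M M<a)

no-213 : ∀ {n w x y z} → InQbar n w → (x ∷ y ∷ z ∷ []) ⊆ w → y < x → x < z → ⊥
no-213 W s y<x x<z with _ ∷ _ ∷ _ ∷ _ ∷ avoids213 ∷ [] ← InQbar.avoidsForbidden W =
  avoids213 s (orderIso-213 y<x x<z)

no-1212 : ∀ {n w a b} → InQbar n w → (a ∷ b ∷ a ∷ b ∷ []) ⊆ w → a < b → ⊥
no-1212 W s a<b with avoids1212 ∷ _ ← InQbar.avoidsForbidden W = avoids1212 s (orderIso-1212 a<b)

no-2121 : ∀ {n w a b} → InQbar n w → (b ∷ a ∷ b ∷ a ∷ []) ⊆ w → a < b → ⊥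
no-2121 W s a<b with _ ∷ avoids2121 ∷ _ ← InQbar.avoidsForbidden W = avoids2121 s (orderIso-2121 a<b)

-- x y z and x z y are occurrences of 123 and 132.
no-smaller-before-pair : ∀ {n W x y z c₁ c₂ w} → InQbar n W → (x ∷ w) ⊆ W → x < y → y < z →
                         Occurs y w (suc c₁) → Occurs z w (suc c₂) → ⊥
no-smaller-before-pair {w = w} W xw⊆W x<y y<z (occurs y-occ) (occurs z-occ)
  with _ ∷ _ ∷ avoids123 ∷ avoids132 ∷ _ ← InQbar.avoidsForbidden W
  with pair⊆⊎swapped⊆ (<⇒≢ y<z) (occ≡suc⇒∈ w y-occ) (occ≡suc⇒∈ w z-occ)
... | inj₁ yz⊆w = avoids123 (⊆-trans (refl ∷ yz⊆w) xw⊆W) (orderIso-123 x<y y<z)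
... | inj₂ zy⊆w = avoids132 (⊆-trans (refl ∷ zy⊆w) xw⊆W) (orderIso-132 x<y y<z)

Complete : ℕ → Set
Complete n = ∀ w → InQbar n w → w ∈ qWords n

module _ (j : ℕ) (ih : ∀ {m} → m < 3 + j → Complete m) where
  private
    K M N : ℕ
    K = suc j
    M = suc K
    N = suc M
    K<M : K < M
    K<M = n<1+n K

  starts-MNNKK : ∀ w → InQbar N (M ∷ N ∷ N ∷ K ∷ K ∷ w) → Occurs K w 0 → Occurs M w 1 → Occurs N w 0 →
                 (M ∷ N ∷ N ∷ K ∷ K ∷ w) ∈ qWords N
  starts-MNNKK []      W k₀ m₁ n₀ = ⊥-elim (occurs-[] m₁)
  starts-MNNKK (c ∷ t) W k₀ m₁ n₀ with rank (letter≤ W (there (there (there (there (there (here refl)))))))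
  ... | largest refl = ⊥-elim (occurs-here-0 n₀)
  ... | second refl = ∈-qWords-233112 j (ih (m<n+m j z<s) t (onTop-InQbar⁻ʳ blk233112-InQbar W))
  ... | lower c<M with m≤n⇒m<n∨m≡n (≤-pred c<M)
  ...   | inj₂ refl = ⊥-elim (occurs-here-0 k₀)
  ...   | inj₁ c<K = ⊥-elim (no-213 W (_ ∷ʳ _ ∷ʳ _ ∷ʳ refl ∷ _ ∷ʳ refl ∷ occurs-later (>⇒≢ c<M) m₁) c<K K<M)

  starts-MNNK : ∀ w → InQbar N (M ∷ N ∷ N ∷ K ∷ w) → Occurs K w 1 → Occurs M w 1 → Occurs N w 0 →
                (M ∷ N ∷ N ∷ K ∷ w) ∈ qWords N
  starts-MNNK []      W k₁ m₁ n₀ = ⊥-elim (occurs-[] m₁)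
  starts-MNNK (b ∷ w) W k₁ m₁ n₀ with rank (letter≤ W (there (there (there (there (here refl))))))
  ... | largest refl = ⊥-elim (occurs-here-0 n₀)
  ... | second refl = ⊥-elim (no-2121 W (refl ∷ _ ∷ʳ _ ∷ʳ refl ∷ refl ∷ occurs-later (<⇒≢ K<M) k₁) K<M)
  ... | lower b<M with m≤n⇒m<n∨m≡n (≤-pred b<M)
  ...   | inj₂ refl =
    starts-MNNKK w W (occurs-here k₁) (occurs-there (>⇒≢ K<M) m₁) (occurs-there (>⇒≢ (m<n⇒m<1+n b<M)) n₀)
  ...   | inj₁ b<K = ⊥-elim (no-213 W (_ ∷ʳ _ ∷ʳ _ ∷ʳ refl ∷ refl ∷ occurs-later (>⇒≢ b<M) m₁) b<K K<M)

  K-twice-after-MNN : ∀ {v} → InQbar N (M ∷ N ∷ N ∷ v) → Occurs K v 2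
  K-twice-after-MNN W = occurs-there K≢N (occurs-there K≢N (occurs-there (<⇒≢ K<M) (occurs-twice W j (m<n+m j z<s))))
    where
    K≢N : K ≢ N
    K≢N = <⇒≢ (m<n⇒m<1+n K<M)

  starts-MNN-smaller : ∀ {a} w → a < M → InQbar N (M ∷ N ∷ N ∷ a ∷ w) →
                       Occurs M (a ∷ w) 1 → Occurs N (a ∷ w) 0 →
                       (M ∷ N ∷ N ∷ a ∷ w) ∈ qWords N
  starts-MNN-smaller w a<M W m₁ n₀ with m≤n⇒m<n∨m≡n (≤-pred a<M)
  ... | inj₂ refl = starts-MNNK w W (occurs-here (K-twice-after-MNN W)) (occurs-there (>⇒≢ a<M) m₁)
                      (occurs-there (>⇒≢ (m<n⇒m<1+n a<M)) n₀)
  ... | inj₁ a<K = ⊥-elim (no-smaller-before-pair W (_ ∷ʳ _ ∷ʳ _ ∷ʳ ⊆-refl) a<K K<M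
                      (occurs-there (>⇒≢ a<K) (K-twice-after-MNN W)) (occurs-there (>⇒≢ a<M) m₁))

starts-MNN-lower : ∀ k → (∀ {m} → m < 2 + k → Complete m) → ∀ {a} w → a < suc k →
                   InQbar (2 + k) (suc k ∷ 2 + k ∷ 2 + k ∷ a ∷ w) →
                   Occurs (suc k) (a ∷ w) 1 → Occurs (2 + k) (a ∷ w) 0 →
                   (suc k ∷ 2 + k ∷ 2 + k ∷ a ∷ w) ∈ qWords (2 + k)
starts-MNN-lower zero    ih w (s≤s a≤0) W with () ← ≤-trans (1≤letter W (there (there (there (here refl))))) a≤0
starts-MNN-lower (suc j) ih = starts-MNN-smaller j ih

module _ (k : ℕ) (ih : ∀ {m} → m < 2 + k → Complete m) where
  private
    M N : ℕ
    M = suc k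
    N = suc M
    M<N : M < N
    M<N = n<1+n M

  via-block₂ : ∀ {c t} → c ∈ blocks₂ → InQbar N (onTop c k t) → onTop c k t ∈ qWords N
  via-block₂ c∈ W = ∈-qWords-2 k c∈ (ih (m<n+m k z<s) _ (onTop-InQbar⁻ʳ (All.lookup blocks₂-InQbar c∈) W))

  starts-MMN : ∀ w → InQbar N (M ∷ M ∷ N ∷ w) → Occurs N w 1 → Occurs M w 0 → (M ∷ M ∷ N ∷ w) ∈ qWords N
  starts-MMN []      W n₁ m₀ = ⊥-elim (occurs-[] n₁)
  starts-MMN (a ∷ t) W n₁ m₀ with rank (letter≤ W (there (there (there (here refl)))))
  ... | second refl = ⊥-elim (occurs-here-0 m₀)
  ... | lower a<M = ⊥-elim (no-213 W (refl ∷ _ ∷ʳ _ ∷ʳ refl ∷ occurs-later (>⇒≢ (m<n⇒m<1+n a<M)) n₁) a<M M<N)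
  ... | largest refl = via-block₂ (there (here refl)) W

  starts-MM : ∀ w → InQbar N (M ∷ M ∷ w) → Occurs N w 2 → Occurs M w 0 → (M ∷ M ∷ w) ∈ qWords N
  starts-MM []      W n₂ m₀ = ⊥-elim (occurs-[] n₂)
  starts-MM (z ∷ w) W n₂ m₀ with rank (letter≤ W (there (there (here refl))))
  ... | second refl = ⊥-elim (occurs-here-0 m₀)
  ... | lower z<M = ⊥-elim (no-213 W (refl ∷ _ ∷ʳ refl ∷ occurs-later (>⇒≢ (m<n⇒m<1+n z<M)) n₂) z<M M<N)
  ... | largest refl = starts-MMN w W (occurs-here n₂) (occurs-there (<⇒≢ M<N) m₀)

  starts-NMM : ∀ w → InQbar N (N ∷ M ∷ M ∷ w) → Occurs N w 1 → Occurs M w 0 → (N ∷ M ∷ M ∷ w) ∈ qWords N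
  starts-NMM []      W n₁ m₀ = ⊥-elim (occurs-[] n₁)
  starts-NMM (a ∷ t) W n₁ m₀ with rank (letter≤ W (there (there (there (here refl)))))
  ... | second refl = ⊥-elim (occurs-here-0 m₀)
  ... | lower a<M = ⊥-elim (no-213 W (_ ∷ʳ refl ∷ _ ∷ʳ refl ∷ occurs-later (>⇒≢ (m<n⇒m<1+n a<M)) n₁) a<M M<N)
  ... | largest refl = via-block₂ (here refl) W

  starts-NM : ∀ w → InQbar N (N ∷ M ∷ w) → Occurs N w 1 → Occurs M w 1 → (N ∷ M ∷ w) ∈ qWords N
  starts-NM []      W n₁ m₁ = ⊥-elim (occurs-[] n₁)
  starts-NM (z ∷ w) W n₁ m₁ with rank (letter≤ W (there (there (here refl))))
  ... | largest refl = ⊥-elim (no-2121 W (refl ∷ refl ∷ refl ∷ occurs-later (<⇒≢ M<N) m₁) M<N)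
  ... | lower z<M = ⊥-elim (no-213 W (_ ∷ʳ refl ∷ refl ∷ occurs-later (>⇒≢ (m<n⇒m<1+n z<M)) n₁) z<M M<N)
  ... | second refl = starts-NMM w W (occurs-there (>⇒≢ M<N) n₁) (occurs-here m₁)

  starts-MNN : ∀ w → InQbar N (M ∷ N ∷ N ∷ w) → Occurs M w 1 → Occurs N w 0 → (M ∷ N ∷ N ∷ w) ∈ qWords N
  starts-MNN []      W m₁ n₀ = ⊥-elim (occurs-[] m₁)
  starts-MNN (a ∷ w) W m₁ n₀ with rank (letter≤ W (there (there (there (here refl)))))
  ... | second refl = via-block₂ (there (there (here refl))) W
  ... | largest refl = ⊥-elim (occurs-here-0 n₀)
  ... | lower a<M = starts-MNN-lower k ih w a<M W m₁ n₀

  starts-MN : ∀ w → InQbar N (M ∷ N ∷ w) → Occurs M w 1 → Occurs N w 1 → (M ∷ N ∷ w) ∈ qWords N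
  starts-MN []      W m₁ n₁ = ⊥-elim (occurs-[] m₁)
  starts-MN (z ∷ w) W m₁ n₁ with rank (letter≤ W (there (there (here refl))))
  ... | lower z<M = ⊥-elim (no-213 W (refl ∷ _ ∷ʳ refl ∷ occurs-later (>⇒≢ (m<n⇒m<1+n z<M)) n₁) z<M M<N)
  ... | second refl = ⊥-elim (no-1212 W (refl ∷ refl ∷ refl ∷ occurs-later (>⇒≢ M<N) n₁) M<N)
  ... | largest refl = starts-MNN w W (occurs-there (<⇒≢ M<N) m₁) (occurs-here n₁)

  starts-M : ∀ w → InQbar N (M ∷ w) → Occurs M w 1 → Occurs N w 2 → (M ∷ w) ∈ qWords N
  starts-M []      W m₁ n₂ = ⊥-elim (occurs-[] m₁)
  starts-M (y ∷ w) W m₁ n₂ with rank (letter≤ W (there (here refl)))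
  ... | lower y<M = ⊥-elim (no-213 W (refl ∷ refl ∷ occurs-later (>⇒≢ (m<n⇒m<1+n y<M)) n₂) y<M M<N)
  ... | second refl = starts-MM w W (occurs-there (>⇒≢ M<N) n₂) (occurs-here m₁)
  ... | largest refl = starts-MN w W (occurs-there (<⇒≢ M<N) m₁) (occurs-here n₂)

starts-N : ∀ m → (∀ {m′} → m′ < suc m → Complete m′) → ∀ w → InQbar (suc m) (suc m ∷ w) →
           (suc m ∷ w) ∈ qWords (suc m)
starts-N m ih [] W = ⊥-elim (occurs-[] (occurs-here (largest-twice W)))
starts-N m ih (y ∷ w) W with rank (letter≤ W (there (here refl)))
... | largest refl = ∈-qWords-11 m (ih (n<1+n m) w (onTop-InQbar⁻ʳ blk11-InQbar W))
starts-N zero ih (y ∷ w) W | second refl with () ← 1≤letter W (there (here refl))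
starts-N (suc k) ih (y ∷ w) W | second refl = starts-NM k ih w W
  (occurs-there (>⇒≢ (n<1+n _)) (occurs-here (largest-twice W))) (occurs-here (occurs-there (<⇒≢ (n<1+n _)) (second-twice W)))
starts-N (suc k) ih (y ∷ w) W | lower y<M = ⊥-elim (no-smaller-before-pair W (_ ∷ʳ ⊆-refl) y<M (n<1+n _)
  (occurs-there (>⇒≢ y<M) (occurs-there (<⇒≢ (n<1+n _)) (second-twice W)))
  (occurs-there (>⇒≢ (m<n⇒m<1+n y<M)) (occurs-here (largest-twice W))))

qWords-complete-step : ∀ m → (∀ {m′} → m′ < suc m → Complete m′) → Complete (suc m)
qWords-complete-step m ih [] W = ⊥-elim (occurs-[] (largest-twice W))
qWords-complete-step m ih (x ∷ w) W with rank (letter≤ W (here refl))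
... | largest refl = starts-N m ih w W
qWords-complete-step zero ih (x ∷ w) W | second refl with () ← 1≤letter W (here refl)
qWords-complete-step (suc k) ih (x ∷ w) W | second refl =
  starts-M k ih w W (occurs-here (second-twice W)) (occurs-there (>⇒≢ (n<1+n _)) (largest-twice W))
qWords-complete-step (suc k) ih (x ∷ w) W | lower x<M = ⊥-elim (no-smaller-before-pair W ⊆-refl x<M (n<1+n _)
  (occurs-there (>⇒≢ x<M) (second-twice W)) (occurs-there (>⇒≢ (m<n⇒m<1+n x<M)) (largest-twice W)))

qWords-complete : ∀ n → Complete n
qWords-complete = <-rec Complete step
  where
  step : ∀ n → (∀ {m} → m < n → Complete m) → Complete n
  step zero    _  []      _ = here refl
  step zero    _  (_ ∷ _) W with () ← InQbar.length≡ W
  step (suc m) ih         = qWords-complete-step m ih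

qbar≡length-qWords : ∀ n → qbar n Λ₃ ≡ length (qWords n)
qbar≡length-qWords n = unique-same-elements⇒length≡ (Qbar-unique n) (qWords-unique n) (mk⇔
  (λ w∈ → qWords-complete n _ (Equivalence.to (∈-Qbar⇔ n _) w∈))
  (λ w∈ → Equivalence.from (∈-Qbar⇔ n _) (qWords-sound n w∈)))

-- The recurrence u(k+3) = u(k+2) + 3u(k+1) + u(k)

Recurrent : (ℕ → ℤ) → Set
Recurrent u = ∀ k → u (3 + k) ≡ u (2 + k) ℤ.+ ℤ.+ 3 ℤ.* u (1 + k) ℤ.+ u k

recurrent-unique : ∀ {u v} → Recurrent u → Recurrent v → u 0 ≡ v 0 → u 1 ≡ v 1 → u 2 ≡ v 2 →
                   ∀ k → u k ≡ v k
recurrent-unique ru rv u₀ u₁ u₂ 0 = u₀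
recurrent-unique ru rv u₀ u₁ u₂ 1 = u₁
recurrent-unique ru rv u₀ u₁ u₂ 2 = u₂
recurrent-unique {u} {v} ru rv u₀ u₁ u₂ (suc (suc (suc k))) = begin
  u (3 + k)                                   ≡⟨ ru k ⟩
  u (2 + k) ℤ.+ ℤ.+ 3 ℤ.* u (1 + k) ℤ.+ u k   ≡⟨ cong₂ ℤ._+_ (cong₂ (λ a b → a ℤ.+ ℤ.+ 3 ℤ.* b)
                                                                (same (suc (suc k))) (same (suc k))) (same k) ⟩
  v (2 + k) ℤ.+ ℤ.+ 3 ℤ.* v (1 + k) ℤ.+ v k   ≡⟨ rv k ⟨
  v (3 + k)                                   ∎
  where
  open ≡-Reasoning
  same : ∀ k → u k ≡ v k
  same = recurrent-unique ru rv u₀ u₁ u₂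

Recurrent-shift : ∀ {u} → Recurrent u → Recurrent (λ k → u (k + 1))
Recurrent-shift ru k = ru (k + 1)

Recurrent-+ : ∀ {u v} → Recurrent u → Recurrent v → Recurrent (λ k → u k ℤ.+ v k)
Recurrent-+ {u} {v} ru rv k =
  trans (cong₂ ℤ._+_ (ru k) (rv k)) (regroup (u (2 + k)) (u (1 + k)) (u k) (v (2 + k)) (v (1 + k)) (v k))
  where
  regroup : ∀ a b c d e f → (a ℤ.+ ℤ.+ 3 ℤ.* b ℤ.+ c) ℤ.+ (d ℤ.+ ℤ.+ 3 ℤ.* e ℤ.+ f)
                            ≡ (a ℤ.+ d) ℤ.+ ℤ.+ 3 ℤ.* (b ℤ.+ e) ℤ.+ (c ℤ.+ f)
  regroup = ℤ-Solver.solve-∀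

Recurrent-*ˡ : ∀ {u} c → Recurrent u → Recurrent (λ k → c ℤ.* u k)
Recurrent-*ˡ {u} c ru k = trans (cong (c ℤ.*_) (ru k)) (distribute c (u (2 + k)) (u (1 + k)) (u k))
  where
  distribute : ∀ c a b d → c ℤ.* (a ℤ.+ ℤ.+ 3 ℤ.* b ℤ.+ d)
                           ≡ c ℤ.* a ℤ.+ ℤ.+ 3 ℤ.* (c ℤ.* b) ℤ.+ c ℤ.* d
  distribute = ℤ-Solver.solve-∀

Recurrent-neg : ∀ {u} → Recurrent u → Recurrent (λ k → ℤ.- u k)
Recurrent-neg {u} ru k = trans (cong ℤ.-_ (ru k)) (distribute (u (2 + k)) (u (1 + k)) (u k))
  where
  distribute : ∀ a b d → ℤ.- (a ℤ.+ ℤ.+ 3 ℤ.* b ℤ.+ d) ≡ ℤ.- a ℤ.+ ℤ.+ 3 ℤ.* (ℤ.- b) ℤ.+ ℤ.- d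
  distribute = ℤ-Solver.solve-∀

Recurrent-pos : ∀ (u : ℕ → ℕ) → (∀ k → u (3 + k) ≡ u (2 + k) + 3 * u (1 + k) + u k) →
                Recurrent (λ k → ℤ.+ u k)
Recurrent-pos u ru k = begin
  ℤ.+ u (3 + k)                                          ≡⟨ cong ℤ.+_ (ru k) ⟩
  ℤ.+ (u (2 + k) + 3 * u (1 + k) + u k)                  ≡⟨ pos-+ (u (2 + k) + 3 * u (1 + k)) (u k) ⟩
  ℤ.+ (u (2 + k) + 3 * u (1 + k)) ℤ.+ ℤ.+ u k            ≡⟨ cong (ℤ._+ ℤ.+ u k) (pos-+ (u (2 + k)) (3 * u (1 + k))) ⟩
  ℤ.+ u (2 + k) ℤ.+ ℤ.+ (3 * u (1 + k)) ℤ.+ ℤ.+ u k      ≡⟨ cong (λ b → ℤ.+ u (2 + k) ℤ.+ b ℤ.+ ℤ.+ u k)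
                                                                   (pos-* 3 (u (1 + k))) ⟩
  ℤ.+ u (2 + k) ℤ.+ ℤ.+ 3 ℤ.* ℤ.+ u (1 + k) ℤ.+ ℤ.+ u k  ∎
  where open ≡-Reasoning

Recurrent-sign : Recurrent (ℤ.-1ℤ ℤ.^_)
Recurrent-sign k = cube (ℤ.-1ℤ ℤ.^ k)
  where
  cube : ∀ s → ℤ.-1ℤ ℤ.* (ℤ.-1ℤ ℤ.* (ℤ.-1ℤ ℤ.* s))
               ≡ ℤ.-1ℤ ℤ.* (ℤ.-1ℤ ℤ.* s) ℤ.+ ℤ.+ 3 ℤ.* (ℤ.-1ℤ ℤ.* s) ℤ.+ s
  cube = ℤ-Solver.solve-∀

open ℤ√2

conj : ℤ√2 → ℤ√2
conj (a + b √2) = a + ℤ.- b √2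

conj-⊗ : ∀ x y → conj (x ⊗ y) ≡ conj x ⊗ conj y
conj-⊗ (a + b √2) (c + d √2) = cong₂ _+_√2 (rational a b c d) (irrational a b c d)
  where
  rational : ∀ a b c d → a ℤ.* c ℤ.+ ℤ.+ 2 ℤ.* b ℤ.* d ≡ a ℤ.* c ℤ.+ ℤ.+ 2 ℤ.* ℤ.- b ℤ.* ℤ.- d
  rational = ℤ-Solver.solve-∀
  irrational : ∀ a b c d → ℤ.- (a ℤ.* d ℤ.+ b ℤ.* c) ≡ a ℤ.* ℤ.- d ℤ.+ ℤ.- b ℤ.* c
  irrational = ℤ-Solver.solve-∀

⊕conj⊖ι : ∀ x c → x ⊕ conj x ⊖ ι c ≡ ι ((re x ℤ.+ re x) ℤ.- c)
⊕conj⊖ι x c = cong (((re x ℤ.+ re x) ℤ.- c) +_√2) (cancel (ir x))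
  where
  cancel : ∀ b → (b ℤ.+ ℤ.- b) ℤ.- ℤ.0ℤ ≡ ℤ.0ℤ
  cancel = ℤ-Solver.solve-∀

conj-^√ : ∀ x k → conj (x ^√ k) ≡ conj x ^√ k
conj-^√ x zero    = refl
conj-^√ x (suc k) = trans (conj-⊗ x (x ^√ k)) (cong (conj x ⊗_) (conj-^√ x k))

Recurrent-re-onePlusSqrt2 : Recurrent (λ k → re (onePlusSqrt2 ^√ k))
Recurrent-re-onePlusSqrt2 k = cube (re (onePlusSqrt2 ^√ k)) (ir (onePlusSqrt2 ^√ k))
  where
  -- (1 + √2)³ = (1 + √2)² + 3 (1 + √2) + 1, read off in the rational part of (1 + √2)³ (A + B√2)
  cube : ∀ A B →
    let a₁ = ℤ.1ℤ ℤ.* A ℤ.+ ℤ.+ 2 ℤ.* ℤ.1ℤ ℤ.* B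
        b₁ = ℤ.1ℤ ℤ.* B ℤ.+ ℤ.1ℤ ℤ.* A
        a₂ = ℤ.1ℤ ℤ.* a₁ ℤ.+ ℤ.+ 2 ℤ.* ℤ.1ℤ ℤ.* b₁
        b₂ = ℤ.1ℤ ℤ.* b₁ ℤ.+ ℤ.1ℤ ℤ.* a₁
    in ℤ.1ℤ ℤ.* a₂ ℤ.+ ℤ.+ 2 ℤ.* ℤ.1ℤ ℤ.* b₂ ≡ a₂ ℤ.+ ℤ.+ 3 ℤ.* a₁ ℤ.+ A
  cube = ℤ-Solver.solve-∀

closedForm : ℕ → ℤ
closedForm k = (re (onePlusSqrt2 ^√ k) ℤ.+ re (onePlusSqrt2 ^√ k)) ℤ.- ℤ.+ 2 ℤ.* ℤ.-1ℤ ℤ.^ k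

Recurrent-closedForm : Recurrent closedForm
Recurrent-closedForm = Recurrent-+ {λ k → a k ℤ.+ a k}
  (Recurrent-+ {a} {a} Recurrent-re-onePlusSqrt2 Recurrent-re-onePlusSqrt2)
  (Recurrent-neg {λ k → ℤ.+ 2 ℤ.* ℤ.-1ℤ ℤ.^ k} (Recurrent-*ˡ {ℤ.-1ℤ ℤ.^_} (ℤ.+ 2) Recurrent-sign))
  where
  a : ℕ → ℤ
  a k = re (onePlusSqrt2 ^√ k)

four-qbar≡closedForm : ∀ n → ℤ.+ (4 * qbar n Λ₃) ≡ closedForm (n + 1)
four-qbar≡closedForm n = begin
  ℤ.+ (4 * qbar n Λ₃)              ≡⟨ cong (λ q → ℤ.+ (4 * q)) (qbar≡length-qWords n) ⟩
  ℤ.+ (4 * length (qWords n))      ≡⟨ pos-* 4 (length (qWords n)) ⟩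
  ℤ.+ 4 ℤ.* ℤ.+ length (qWords n)  ≡⟨ four-lengths n ⟩
  closedForm (n + 1)               ∎
  where
  open ≡-Reasoning
  four-lengths : ∀ n → ℤ.+ 4 ℤ.* ℤ.+ length (qWords n) ≡ closedForm (n + 1)
  four-lengths = recurrent-unique {v = λ k → closedForm (k + 1)}
    (Recurrent-*ˡ {λ k → ℤ.+ length (qWords k)} (ℤ.+ 4) (Recurrent-pos (length ∘ qWords) length-qWords))
    (Recurrent-shift {closedForm} Recurrent-closedForm)
    refl refl refl

-- The identity holds for n = 0 as well.
theorem4p12 : (n : ℕ) → n ≥ 1 →
    ι (ℤ.+ (4 * qbar n ((1 ∷ 2 ∷ 3 ∷ []) ∷ (1 ∷ 3 ∷ 2 ∷ []) ∷ (2 ∷ 1 ∷ 3 ∷ []) ∷ [])))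
      ≡ (onePlusSqrt2 ^√ (n + 1)) ⊕ (oneMinusSqrt2 ^√ (n + 1))
          ⊖ ι (ℤ.+ 2 ℤ.* (ℤ.-1ℤ ℤ.^ (n + 1)))
theorem4p12 n _ = begin
  ι (ℤ.+ (4 * qbar n Λ₃))                        ≡⟨ cong ι (four-qbar≡closedForm n) ⟩
  ι (closedForm (n + 1))                         ≡⟨ ⊕conj⊖ι α^[n+1] twoSign ⟨
  α^[n+1] ⊕ conj α^[n+1] ⊖ ι twoSign             ≡⟨ cong (λ β → α^[n+1] ⊕ β ⊖ ι twoSign)
                                                         (conj-^√ onePlusSqrt2 (n + 1)) ⟩
  α^[n+1] ⊕ (oneMinusSqrt2 ^√ (n + 1)) ⊖ ι twoSign ∎
  where
  open ≡-Reasoning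
  α^[n+1] : ℤ√2
  α^[n+1] = onePlusSqrt2 ^√ (n + 1)
  twoSign : ℤ
  twoSign = ℤ.+ 2 ℤ.* ℤ.-1ℤ ℤ.^ (n + 1)
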